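{- Consider a partial packing of the three bins $A,B,C$ (all current loads at most $22$) such that $s(A)+s(B)\ge 15+\tfrac12 s(C)$, $s(B)<4$ and $s(C)<4$. Then there exists an online algorithm that, continuing from this partial packing, packs all remaining items of the input sequence into the three bins so that every bin has load at most $22$.
   Context: Scaled setting of Online Bin Stretching with three bins: items with sizes in $[0,16]$ arrive online one by one and each must be packed immediately and irrevocably into one of three bins $A,B,C$; it is guaranteed that the whole input sequence (items already packed together with all future items) can be packed offline into three bins of capacity $16$. A partial packing is an assignment of each item of some prefix of the input sequence (the items arrived so far) to one of the bins $A,B,C$. For a bin $X$, $s(X)$ denotes the total size of items currently assigned to $X$. The online algorithm must handle every possible continuation of the input satisfying the guarantee.
   Formalization: Item sizes, both in the given partial packing and in every continuation of the input sequence, are rational. -}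

module Defs where

open import Data.Rational using (ℚ; 0ℚ; _+_; _*_; _≤_; _<_; ½; _/_)
open import Data.Nat using (ℕ)
open import Data.Integer using (+_)
open import Data.List using (List; []; _∷_; map; _++_; length; zip)
open import Data.Product using (_×_; _,_; proj₁; Σ)
open import Data.List.Relation.Unary.All using (All)
open import Relation.Binary.PropositionalEquality using (_≡_)

fromℕ : ℕ → ℚ
fromℕ n = (+ n) / 1

data Bin : Set where
  A B C : Bin

open import Data.Bool using (Bool; true; false; if_then_else_)

_==_ : Bin → Bin → Bool
A == A = true
B == B = true
C == C = true
_ == _ = false

-- A (partial) packing: list of (item size, bin it was placed into).
-- Newest item first.
Packing : Set
Packing = List (ℚ × Bin)

load : Packing → Bin → ℚ
load [] X = 0ℚ
load ((x , Y) ∷ p) X = if Y == X then x + load p X else load p X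

items : Packing → List ℚ
items = map proj₁

ValidItem : ℚ → Set
ValidItem x = (0ℚ ≤ x) × (x ≤ fromℕ 16)

OfflinePackable : List ℚ → Set
OfflinePackable xs =
  Σ (List Bin) λ as → (length as ≡ length xs) × (∀ X → load (zip xs as) X ≤ fromℕ 16)

-- A (deterministic) online algorithm: given the current partial packing
-- (the complete history) and the newly arrived item, choose a bin.
OnlineAlg : Set
OnlineAlg = Packing → ℚ → Bin

run : OnlineAlg → Packing → List ℚ → Packing
run alg p [] = p
run alg p (x ∷ xs) = run alg ((x , alg p x) ∷ p) xs

-- While no two bins hold 26 together, an item goes to A if it fits, otherwise to B if that
-- makes a + b ≥ 26, otherwise to C.  Once two bins hold 26, the third takes every remaining item:
-- offline packability bounds the total by 48.  The first phase keeps the invariant b < 4,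
-- a + b ≥ 15, c + 4 ≤ a + b and (a + b ≥ 15 + c/2 or a + c > 22).  An item x sent to C has
-- a + x + b < 26, so x + c < 22; afterwards a + c > 22, and c + 4 ≤ a + b persists either by
-- a + b ≥ 15 + c/2 or because x + a > 22, a + c > 22 and a + x + c < 26 force x + c < 8.
module Submission where

open import Defs
open import Data.Rational using (ℚ; 0ℚ; _+_; _*_; _-_; -_; _≤_; _<_; ½)
open import Data.Rational.Properties
  using (<⇒≤; ≰⇒>; _≤?_; +-mono-≤; +-mono-<-≤; +-monoˡ-≤; +-monoˡ-<;
         +-assoc; +-identityˡ; *-monoˡ-≤-nonNeg; nonNegative⁻¹)
open import Data.Rational.Solver using (module +-*-Solver)
open +-*-Solver
open import Data.List using (List; []; _∷_; _++_; foldr; zip; length)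
open import Data.List.Relation.Unary.All using (All; []; _∷_)
open import Data.Product using (Σ; _,_)
open import Data.Sum using (_⊎_; inj₁; inj₂; [_,_])
open import Data.Bool using (true; false; if_then_else_)
import Data.Nat.Properties as ℕ
open import Relation.Nullary using (yes; no; ¬_; contradiction)
open import Relation.Binary.PropositionalEquality
  using (_≡_; refl; sym; trans; cong; subst; subst₂; module ≡-Reasoning)

p≤q⇒0≤q-p : ∀ {p q} → p ≤ q → 0ℚ ≤ q - p
p≤q⇒0≤q-p {p} {q} p≤q =
  subst₂ _≤_ (solve 1 (λ p → p :- p := con 0ℚ) refl p) refl (+-monoˡ-≤ (- p) p≤q)

p<q⇒0<q-p : ∀ {p q} → p < q → 0ℚ < q - p
p<q⇒0<q-p {p} {q} p<q =
  subst₂ _<_ (solve 1 (λ p → p :- p := con 0ℚ) refl p) refl (+-monoˡ-< (- p) p<q)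

-- Slacks are added with +-mono-≤, whose 0ℚ + 0ℚ on the left reduces to 0ℚ.
≤-by-slack : ∀ {p q e} → 0ℚ ≤ e → e ≡ q - p → p ≤ q
≤-by-slack {p} {q} 0≤e refl =
  subst₂ _≤_ (+-identityˡ p) (solve 2 (λ p q → (q :- p) :+ p := q) refl p q) (+-monoˡ-≤ p 0≤e)

<-by-slack : ∀ {p q e} → 0ℚ < e → e ≡ q - p → p < q
<-by-slack {p} {q} 0<e refl =
  subst₂ _<_ (+-identityˡ p) (solve 2 (λ p q → (q :- p) :+ p := q) refl p q) (+-monoˡ-< p 0<e)

grow-≤ : ∀ {p a q x} → 0ℚ ≤ x → p ≤ a + q → p ≤ (x + a) + q
grow-≤ {p} {a} {q} {x} 0≤x p≤a+q = ≤-by-slack (+-mono-≤ (p≤q⇒0≤q-p p≤a+q) 0≤x)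
  (solve 4 (λ p a q x → ((a :+ q) :- p) :+ x := ((x :+ a) :+ q) :- p) refl p a q x)

grow-< : ∀ {p a q x} → 0ℚ ≤ x → p < a + q → p < (x + a) + q
grow-< {p} {a} {q} {x} 0≤x p<a+q = <-by-slack (+-mono-<-≤ (p<q⇒0<q-p p<a+q) 0≤x)
  (solve 4 (λ p a q x → ((a :+ q) :- p) :+ x := ((x :+ a) :+ q) :- p) refl p a q x)

∑ : List ℚ → ℚ
∑ = foldr _+_ 0ℚ

∑-++ : ∀ xs ys → ∑ (xs ++ ys) ≡ ∑ xs + ∑ ys
∑-++ []       ys = sym (+-identityˡ (∑ ys))
∑-++ (x ∷ xs) ys = trans (cong (x +_) (∑-++ xs ys)) (sym (+-assoc x (∑ xs) (∑ ys)))

∑-nonNeg : ∀ {xs} → All ValidItem xs → 0ℚ ≤ ∑ xs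
∑-nonNeg []               = nonNegative⁻¹ 0ℚ
∑-nonNeg ((0≤x , _) ∷ vs) = +-mono-≤ 0≤x (∑-nonNeg vs)

total : Packing → ℚ
total p = load p A + load p B + load p C

-- load ((x , Y) ∷ p) X reduces to put Y x X (load p X).
put : Bin → ℚ → Bin → ℚ → ℚ
put Y x X l = if Y == X then x + l else l

total-put : ∀ Y x a b c → put Y x A a + put Y x B b + put Y x C c ≡ x + (a + b + c)
total-put A x a b c = solve 4 (λ a b c x → (x :+ a) :+ b :+ c := x :+ (a :+ b :+ c)) refl a b c x
total-put B x a b c = solve 4 (λ a b c x → a :+ (x :+ b) :+ c := x :+ (a :+ b :+ c)) refl a b c x
total-put C x a b c = solve 4 (λ a b c x → a :+ b :+ (x :+ c) := x :+ (a :+ b :+ c)) refl a b c x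

total-∷ : ∀ x Y p → total ((x , Y) ∷ p) ≡ x + total p
total-∷ x Y p = total-put Y x (load p A) (load p B) (load p C)

∑-items : ∀ p → ∑ (items p) ≡ total p
∑-items []            = refl
∑-items ((x , Y) ∷ p) = trans (cong (x +_) (∑-items p)) (sym (total-∷ x Y p))

items-zip : ∀ xs (ys : List Bin) → length ys ≡ length xs → items (zip xs ys) ≡ xs
items-zip []       []       _  = refl
items-zip (x ∷ xs) (y ∷ ys) eq = cong (x ∷_) (items-zip xs ys (ℕ.suc-injective eq))

OfflinePackable⇒∑≤48 : ∀ xs → OfflinePackable xs → ∑ xs ≤ fromℕ 48
OfflinePackable⇒∑≤48 xs (ys , eq , fits) =
  subst (_≤ fromℕ 48) (trans (sym (∑-items (zip xs ys))) (cong ∑ (items-zip xs ys eq)))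
    (+-mono-≤ (+-mono-≤ (fits A) (fits B)) (fits C))

chooseFirstPhase : ℚ → ℚ → ℚ → ℚ → Bin
chooseFirstPhase a b c x with x + a ≤? fromℕ 22
... | yes _ = A
... | no _ with fromℕ 26 ≤? a + (x + b)
...   | yes _ = B
...   | no _  = C

choose : ℚ → ℚ → ℚ → ℚ → Bin
choose a b c x with fromℕ 26 ≤? a + b
... | yes _ = C
... | no _ with fromℕ 26 ≤? a + c
...   | yes _ = B
...   | no _ with fromℕ 26 ≤? b + c
...     | yes _ = A
...     | no _  = chooseFirstPhase a b c x

stretch : OnlineAlg
stretch p x = choose (load p A) (load p B) (load p C) x

SomePair≥26 : ℚ → ℚ → ℚ → Set
SomePair≥26 a b c = fromℕ 26 ≤ a + b ⊎ fromℕ 26 ≤ a + c ⊎ fromℕ 26 ≤ b + c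

record FirstPhase (a b c : ℚ) : Set where
  field
    0≤c     : 0ℚ ≤ c
    b<4     : b < fromℕ 4
    15≤a+b  : fromℕ 15 ≤ a + b
    c+4≤a+b : c + fromℕ 4 ≤ a + b
    balance : fromℕ 15 + ½ * c ≤ a + b ⊎ fromℕ 22 < a + c

record Invariant (a b c : ℚ) : Set where
  constructor invariant
  field
    a≤22  : a ≤ fromℕ 22
    b≤22  : b ≤ fromℕ 22
    c≤22  : c ≤ fromℕ 22
    phase : SomePair≥26 a b c ⊎ FirstPhase a b c

InvariantAfter : Bin → ℚ → ℚ → ℚ → ℚ → Set
InvariantAfter Y x a b c = Invariant (put Y x A a) (put Y x B b) (put Y x C c)

third-bin-fits : ∀ u v w {t} x → fromℕ 26 ≤ u + v → u + v + w ≡ t →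
                 t + x ≤ fromℕ 48 → x + w ≤ fromℕ 22
third-bin-fits u v w x full refl u+v+w+x≤48 =
  ≤-by-slack (+-mono-≤ (p≤q⇒0≤q-p u+v+w+x≤48) (p≤q⇒0≤q-p full))
    (solve 4 (λ u v w x → (con (fromℕ 48) :- (u :+ v :+ w :+ x)) :+ ((u :+ v) :- con (fromℕ 26))
                          := con (fromℕ 22) :- (x :+ w)) refl u v w x)

firstPhase-initial : ∀ {a b c} → 0ℚ ≤ c → b < fromℕ 4 → c < fromℕ 4 →
                     fromℕ 15 + ½ * c ≤ a + b → FirstPhase a b c
firstPhase-initial {a} {b} {c} 0≤c b<4 c<4 balanced = record
  { 0≤c     = 0≤c
  ; b<4     = b<4
  ; 15≤a+b  = ≤-by-slack (+-mono-≤ (p≤q⇒0≤q-p balanced) (*-monoˡ-≤-nonNeg ½ 0≤c))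
      (solve 3 (λ a b c → ((a :+ b) :- (con (fromℕ 15) :+ con ½ :* c)) :+ con ½ :* c
                          := (a :+ b) :- con (fromℕ 15)) refl a b c)
  ; c+4≤a+b = ≤-by-slack
      (+-mono-≤ (+-mono-≤ (p≤q⇒0≤q-p balanced) (*-monoˡ-≤-nonNeg ½ (p≤q⇒0≤q-p (<⇒≤ c<4))))
                (nonNegative⁻¹ (fromℕ 9)))
      (solve 3 (λ a b c → (((a :+ b) :- (con (fromℕ 15) :+ con ½ :* c))
                            :+ con ½ :* (con (fromℕ 4) :- c))
                          :+ con (fromℕ 9) := (a :+ b) :- (c :+ con (fromℕ 4))) refl a b c)
  ; balance = inj₁ balanced
  }

firstPhase-putA : ∀ {a b c x} → 0ℚ ≤ x → FirstPhase a b c → FirstPhase (x + a) b c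
firstPhase-putA 0≤x fp = record
  { 0≤c     = 0≤c
  ; b<4     = b<4
  ; 15≤a+b  = grow-≤ 0≤x 15≤a+b
  ; c+4≤a+b = grow-≤ 0≤x c+4≤a+b
  ; balance = [ (λ h → inj₁ (grow-≤ 0≤x h)) , (λ h → inj₂ (grow-< 0≤x h)) ] balance
  }
  where open FirstPhase fp

putB-fits : ∀ {b x} → b < fromℕ 4 → x ≤ fromℕ 16 → x + b ≤ fromℕ 22
putB-fits {b} {x} b<4 x≤16 =
  ≤-by-slack (+-mono-≤ (+-mono-≤ (p≤q⇒0≤q-p (<⇒≤ b<4)) (p≤q⇒0≤q-p x≤16)) (nonNegative⁻¹ (fromℕ 2)))
    (solve 2 (λ b x → ((con (fromℕ 4) :- b) :+ (con (fromℕ 16) :- x)) :+ con (fromℕ 2)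
                      := con (fromℕ 22) :- (x :+ b)) refl b x)

putC-fits : ∀ {a b c x} → c + fromℕ 4 ≤ a + b → a + (x + b) < fromℕ 26 → x + c ≤ fromℕ 22
putC-fits {a} {b} {c} {x} c+4≤a+b a+x+b<26 =
  ≤-by-slack (+-mono-≤ (p≤q⇒0≤q-p c+4≤a+b) (<⇒≤ (p<q⇒0<q-p a+x+b<26)))
    (solve 4 (λ a b c x → ((a :+ b) :- (c :+ con (fromℕ 4))) :+ (con (fromℕ 26) :- (a :+ (x :+ b)))
                          := con (fromℕ 22) :- (x :+ c)) refl a b c x)

firstPhase-putC : ∀ {a b c x} → 0ℚ ≤ x → fromℕ 22 < x + a → a + (x + b) < fromℕ 26 →
                  a + (x + c) < fromℕ 26 → FirstPhase a b c → FirstPhase a b (x + c)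
firstPhase-putC {a} {b} {c} {x} 0≤x x+a>22 a+x+b<26 a+x+c<26 fp = record
  { 0≤c     = +-mono-≤ 0≤x 0≤c
  ; b<4     = b<4
  ; 15≤a+b  = 15≤a+b
  ; c+4≤a+b = [ via-balance , via-a+c>22 ] balance
  ; balance = inj₂ (<-by-slack (+-mono-<-≤ (p<q⇒0<q-p x+a>22) 0≤c)
      (solve 3 (λ a c x → ((x :+ a) :- con (fromℕ 22)) :+ c
                          := (a :+ (x :+ c)) :- con (fromℕ 22)) refl a c x))
  }
  where
  open FirstPhase fp
  slack-x+b : 0ℚ ≤ fromℕ 26 - (a + (x + b))
  slack-x+b = <⇒≤ (p<q⇒0<q-p a+x+b<26)
  slack-x+c : 0ℚ ≤ fromℕ 26 - (a + (x + c))
  slack-x+c = <⇒≤ (p<q⇒0<q-p a+x+c<26)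

  via-balance : fromℕ 15 + ½ * c ≤ a + b → (x + c) + fromℕ 4 ≤ a + b
  via-balance h = ≤-by-slack (+-mono-≤ (+-mono-≤ (p≤q⇒0≤q-p h) (p≤q⇒0≤q-p h)) slack-x+b)
    (solve 4 (λ a b c x → (((a :+ b) :- (con (fromℕ 15) :+ con ½ :* c))
                            :+ ((a :+ b) :- (con (fromℕ 15) :+ con ½ :* c)))
                          :+ (con (fromℕ 26) :- (a :+ (x :+ b)))
                          := (a :+ b) :- ((x :+ c) :+ con (fromℕ 4))) refl a b c x)

  via-a+c>22 : fromℕ 22 < a + c → (x + c) + fromℕ 4 ≤ a + b
  via-a+c>22 h = ≤-by-slack
    (+-mono-≤ (+-mono-≤ (+-mono-≤ (<⇒≤ (p<q⇒0<q-p h)) (<⇒≤ (p<q⇒0<q-p x+a>22)))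
                        (+-mono-≤ slack-x+c slack-x+c))
              (+-mono-≤ (p≤q⇒0≤q-p 15≤a+b) (nonNegative⁻¹ (fromℕ 3))))
    (solve 4 (λ a b c x → ((((a :+ c) :- con (fromℕ 22)) :+ ((x :+ a) :- con (fromℕ 22)))
                            :+ ((con (fromℕ 26) :- (a :+ (x :+ c)))
                                :+ (con (fromℕ 26) :- (a :+ (x :+ c)))))
                          :+ (((a :+ b) :- con (fromℕ 15)) :+ con (fromℕ 3))
                          := (a :+ b) :- ((x :+ c) :+ con (fromℕ 4))) refl a b c x)

noPair⇒firstPhase : ∀ {a b c} → ¬ fromℕ 26 ≤ a + b → ¬ fromℕ 26 ≤ a + c → ¬ fromℕ 26 ≤ b + c →
                    SomePair≥26 a b c ⊎ FirstPhase a b c → FirstPhase a b c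
noPair⇒firstPhase ¬ab ¬ac ¬bc (inj₁ (inj₁ ab))        = contradiction ab ¬ab
noPair⇒firstPhase ¬ab ¬ac ¬bc (inj₁ (inj₂ (inj₁ ac))) = contradiction ac ¬ac
noPair⇒firstPhase ¬ab ¬ac ¬bc (inj₁ (inj₂ (inj₂ bc))) = contradiction bc ¬bc
noPair⇒firstPhase ¬ab ¬ac ¬bc (inj₂ fp)               = fp

chooseFirstPhase-preserves-Invariant : ∀ {a b c} x → 0ℚ ≤ x → x ≤ fromℕ 16 →
                  a ≤ fromℕ 22 → b ≤ fromℕ 22 → c ≤ fromℕ 22 → FirstPhase a b c →
                  InvariantAfter (chooseFirstPhase a b c x) x a b c
chooseFirstPhase-preserves-Invariant {a} {b} {c} x 0≤x x≤16 a≤22 b≤22 c≤22 fp with x + a ≤? fromℕ 22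
... | yes x+a≤22 = invariant x+a≤22 b≤22 c≤22 (inj₂ (firstPhase-putA 0≤x fp))
... | no x+a≰22 with fromℕ 26 ≤? a + (x + b)
...   | yes a+x+b≥26 =
  invariant a≤22 (putB-fits (FirstPhase.b<4 fp) x≤16) c≤22 (inj₁ (inj₁ a+x+b≥26))
...   | no a+x+b≱26  =
  invariant a≤22 b≤22 (putC-fits {a} {b} {c} {x} (FirstPhase.c+4≤a+b fp) (≰⇒> a+x+b≱26)) phaseAfterC
  where
  phaseAfterC : SomePair≥26 a b (x + c) ⊎ FirstPhase a b (x + c)
  phaseAfterC with fromℕ 26 ≤? a + (x + c)
  ... | yes a+x+c≥26 = inj₁ (inj₂ (inj₁ a+x+c≥26))
  ... | no a+x+c≱26  = inj₂ (firstPhase-putC 0≤x (≰⇒> x+a≰22) (≰⇒> a+x+b≱26) (≰⇒> a+x+c≱26) fp)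

choose-preserves-Invariant : ∀ {a b c} x → 0ℚ ≤ x → x ≤ fromℕ 16 → a + b + c + x ≤ fromℕ 48 →
                             Invariant a b c →
       InvariantAfter (choose a b c x) x a b c
choose-preserves-Invariant {a} {b} {c} x 0≤x x≤16 bound (invariant a≤22 b≤22 c≤22 phase)
  with fromℕ 26 ≤? a + b
... | yes ab = invariant a≤22 b≤22 (third-bin-fits a b c x ab refl bound) (inj₁ (inj₁ ab))
... | no ¬ab with fromℕ 26 ≤? a + c
...   | yes ac =
  invariant a≤22 (third-bin-fits a c b x ac a+c+b≡a+b+c bound) c≤22 (inj₁ (inj₂ (inj₁ ac)))
  where
  a+c+b≡a+b+c : a + c + b ≡ a + b + c
  a+c+b≡a+b+c = solve 3 (λ a b c → a :+ c :+ b := a :+ b :+ c) refl a b c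
...   | no ¬ac with fromℕ 26 ≤? b + c
...     | yes bc =
  invariant (third-bin-fits b c a x bc b+c+a≡a+b+c bound) b≤22 c≤22 (inj₁ (inj₂ (inj₂ bc)))
  where
  b+c+a≡a+b+c : b + c + a ≡ a + b + c
  b+c+a≡a+b+c = solve 3 (λ a b c → b :+ c :+ a := a :+ b :+ c) refl a b c
...     | no ¬bc =
  chooseFirstPhase-preserves-Invariant x 0≤x x≤16 a≤22 b≤22 c≤22
    (noPair⇒firstPhase ¬ab ¬ac ¬bc phase)

load-nonNeg : ∀ p → All ValidItem (items p) → ∀ X → 0ℚ ≤ load p X
load-nonNeg []            _                  X = nonNegative⁻¹ 0ℚ
load-nonNeg ((x , Y) ∷ p) ((0≤x , _) ∷ valid) X with Y == X
... | true  = +-mono-≤ 0≤x (load-nonNeg p valid X)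
... | false = load-nonNeg p valid X

load-run-stretch-≤22 : ∀ p xs → Invariant (load p A) (load p B) (load p C) → All ValidItem xs →
              total p + ∑ xs ≤ fromℕ 48 → ∀ X → load (run stretch p xs) X ≤ fromℕ 22
load-run-stretch-≤22 p []       inv _ _ A = Invariant.a≤22 inv
load-run-stretch-≤22 p []       inv _ _ B = Invariant.b≤22 inv
load-run-stretch-≤22 p []       inv _ _ C = Invariant.c≤22 inv
load-run-stretch-≤22 p (x ∷ xs) inv ((0≤x , x≤16) ∷ valid) bound =
  load-run-stretch-≤22 ((x , stretch p x) ∷ p) xs
    (choose-preserves-Invariant x 0≤x x≤16 bound-now inv) valid bound-later
  where
  t : ℚ
  t = total p
  s : ℚ
  s = ∑ xs

  bound-now : t + x ≤ fromℕ 48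
  bound-now = ≤-by-slack (+-mono-≤ (p≤q⇒0≤q-p bound) (∑-nonNeg valid))
    (solve 3 (λ t x s → (con (fromℕ 48) :- (t :+ (x :+ s))) :+ s
                        := con (fromℕ 48) :- (t :+ x)) refl t x s)

  bound-later : total ((x , stretch p x) ∷ p) + s ≤ fromℕ 48
  bound-later = subst (_≤ fromℕ 48) t+[x+s]≡total′+s bound
    where
    open ≡-Reasoning
    t+[x+s]≡total′+s : t + (x + s) ≡ total ((x , stretch p x) ∷ p) + s
    t+[x+s]≡total′+s = begin
      t + (x + s)                       ≡⟨ solve 3 (λ t x s → t :+ (x :+ s) := (x :+ t) :+ s) refl t x s ⟩
      (x + t) + s                       ≡⟨ cong (_+ s) (total-∷ x (stretch p x) p) ⟨
      total ((x , stretch p x) ∷ p) + s ∎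

mainTheorem7 : (p : Packing) →
    All ValidItem (items p) →
    (∀ X → load p X ≤ fromℕ 22) →
    fromℕ 15 + ½ * load p C ≤ load p A + load p B →
    load p B < fromℕ 4 →
    load p C < fromℕ 4 →
    Σ OnlineAlg λ alg →
      (xs : List ℚ) →
      All ValidItem xs →
      OfflinePackable (items p ++ xs) →
      ∀ X → load (run alg p xs) X ≤ fromℕ 22
mainTheorem7 p valid fits balanced b<4 c<4 =
  stretch , λ xs valid-xs packable →
    load-run-stretch-≤22 p xs initial valid-xs (total-bound xs packable)
  where
  initial : Invariant (load p A) (load p B) (load p C)
  initial = invariant (fits A) (fits B) (fits C)
    (inj₂ (firstPhase-initial (load-nonNeg p valid C) b<4 c<4 balanced))

  total-bound : ∀ xs → OfflinePackable (items p ++ xs) → total p + ∑ xs ≤ fromℕ 48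
  total-bound xs packable =
    subst (_≤ fromℕ 48) (trans (∑-++ (items p) xs) (cong (_+ ∑ xs) (∑-items p)))
      (OfflinePackable⇒∑≤48 (items p ++ xs) packable)
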